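{- For $n\ge1$, let $G_n(q,t)=\sum_{\sigma\in\mathcal{R}_n^B}q^{\mathrm{des}(\sigma)}t^{\mathrm{maj}(\sigma)}$. Then \[ G_n(q,t)=q^{n-1}t^{\binom n2}G_n(q^{ -1},t^{ -1}). \]
   Context: $[n]=\{1,\dots,n\}$, $\langle n\rangle=\{0,\pm1,\dots,\pm n\}$. A type $B$ set partition of $\langle n\rangle$ without zero block is encoded as $\pi=\pi_1\mid\cdots\mid\pi_k$: nonempty sets of nonzero integers with the sets $\{|a|:a\in\pi_i\}$ partitioning $[n]$, the element of smallest absolute value $m_i$ of $\pi_i$ positive, $m_1<\cdots<m_k$. It is merging-free if there is no $i\ge2$ with $\max_{a\in\pi_{i-1}}|a|<m_i$. $\mathrm{Flatten}(\pi)$ concatenates $\pi_1,\pi_2,\dots$, each written in increasing order of absolute value; $\mathcal{R}_n^B$ is the set of $\mathrm{Flatten}(\pi)$ over merging-free $\pi$. For $\sigma=\sigma_1\cdots\sigma_n$, $i\in[n-1]$ is a descent if $\sigma_i>\sigma_{i+1}$ (usual integer order); $\mathrm{des}(\sigma)$ is the number of descents and $\mathrm{maj}(\sigma)$ their sum. -}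

module Defs where

open import Data.Bool using (Bool; true; false; _∧_; not)
open import Data.Nat as ℕ using (ℕ; zero; suc; _<ᵇ_; _≡ᵇ_; _⊔_; _+_)
open import Data.Integer as ℤ using (ℤ; +_; -[1+_]; ∣_∣)
open import Data.List using (List; []; _∷_; map; concatMap; concat; upTo; length; filterᵇ; foldr)
open import Data.Bool.ListAction using (any; all)
open import Relation.Nullary using (does)

letters : ℕ → List ℤ
letters n = concatMap (λ i → (+ suc i) ∷ -[1+ i ] ∷ []) (upTo n)

words : ℕ → ℕ → List (List ℤ)
words n zero    = [] ∷ []
words n (suc k) = concatMap (λ a → map (a ∷_) (words n k)) (letters n)

splits : List ℤ → List (List (List ℤ))
splits []       = [] ∷ []
splits (x ∷ xs) = concatMap ext (splits xs)
  where
  ext : List (List ℤ) → List (List (List ℤ))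
  ext []       = ((x ∷ []) ∷ []) ∷ []
  ext (b ∷ bs) = ((x ∷ []) ∷ b ∷ bs) ∷ ((x ∷ b) ∷ bs) ∷ []

absIncreasing : List ℤ → Bool
absIncreasing []           = true
absIncreasing (x ∷ [])     = true
absIncreasing (x ∷ y ∷ xs) = (∣ x ∣ <ᵇ ∣ y ∣) ∧ absIncreasing (y ∷ xs)

isPos : ℤ → Bool
isPos (+ zero)  = false
isPos (+ suc _) = true
isPos -[1+ _ ]  = false

blockOK : List ℤ → Bool
blockOK []       = false
blockOK (x ∷ xs) = isPos x ∧ absIncreasing (x ∷ xs)

minAbs : List ℤ → ℕ
minAbs []      = 0
minAbs (x ∷ _) = ∣ x ∣

maxAbs : List ℤ → ℕ
maxAbs b = foldr (λ x r → ∣ x ∣ ⊔ r) 0 b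

minsIncreasing : List (List ℤ) → Bool
minsIncreasing []           = true
minsIncreasing (b ∷ [])     = true
minsIncreasing (b ∷ c ∷ bs) = (minAbs b <ᵇ minAbs c) ∧ minsIncreasing (c ∷ bs)

mergingFree : List (List ℤ) → Bool
mergingFree []           = true
mergingFree (b ∷ [])     = true
mergingFree (b ∷ c ∷ bs) = not (maxAbs b <ᵇ minAbs c) ∧ mergingFree (c ∷ bs)

occurs : ℕ → List ℕ → Bool
occurs i = any (λ j → i ≡ᵇ j)

-- The sets {|a| : a ∈ π_i} partition [n]: the absolute values of all entries,
-- listed, are exactly 1..n each once (length n and every i ∈ [n] occurs).
coversN : ℕ → List ℤ → Bool
coversN n w = (length w ≡ᵇ n) ∧ all (λ i → occurs (suc i) (map ∣_∣ w)) (upTo n)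

-- π (blocks listed in order, each in increasing absolute value) is a type B
-- set partition of ⟨n⟩ without zero block, in the standard encoding.
isTypeBPartition : ℕ → List (List ℤ) → Bool
isTypeBPartition n π = all blockOK π ∧ minsIncreasing π ∧ coversN n (concat π)

flatten : List (List ℤ) → List ℤ
flatten = concat

-- σ ∈ R_n^B iff σ = Flatten(π) for some merging-free type B partition π.
-- Every π with Flatten(π) = σ is one of the cuttings `splits σ`.
inRB : ℕ → List ℤ → Bool
inRB n σ = any (λ π → isTypeBPartition n π ∧ mergingFree π) (splits σ)

-- R_n^B as a duplicate-free list (words of length n over ±[n] in R_n^B).
RB : ℕ → List (List ℤ)
RB n = filterᵇ (inRB n) (words n n)

-- Descents in the usual integer order.
isDescent : ℤ → ℤ → Bool
isDescent x y = does (y ℤ.<? x)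

des : List ℤ → ℕ
des []           = 0
des (x ∷ [])     = 0
des (x ∷ y ∷ xs) = (if isDescent x y then 1 else 0) + des (y ∷ xs)
  where open import Data.Bool using (if_then_else_)

majFrom : ℕ → List ℤ → ℕ
majFrom i []           = 0
majFrom i (x ∷ [])     = 0
majFrom i (x ∷ y ∷ xs) = (if isDescent x y then i else 0) + majFrom (suc i) (y ∷ xs)
  where open import Data.Bool using (if_then_else_)

maj : List ℤ → ℕ
maj = majFrom 1

-- Coefficient of q^d t^m in G_n(q,t) = Σ_{σ ∈ R_n^B} q^{des σ} t^{maj σ},
-- for arbitrary integer exponents d, m (Laurent polynomial coefficients).
coeffG : ℕ → ℤ → ℤ → ℕ
coeffG n d m =
  length (filterᵇ (λ σ → does ((+ des σ) ℤ.≟ d) ∧ does ((+ maj σ) ℤ.≟ m)) (RB n))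

-- Let φ negate every entry of a signed word whose absolute value exceeds that of its predecessor.
-- It is an involution made of sign changes that depend only on absolute values, so it permutes the
-- words of length n. If σ = Flatten(π) with π merging-free, the blocks of π are the maximal runs of
-- increasing absolute value and consecutive blocks meet in a strict fall; hence φ σ = Flatten(π′),
-- where π′ negates all but the first entry of every block and is again merging-free, so φ preserves
-- R_n^B. The comparison of two entries of different absolute value is decided by the sign of the
-- larger one, and φ negates the larger entry of every adjacent pair of σ ∈ R_n^B, so σ and φ σ have
-- complementary descent sets: des σ + des (φ σ) = n - 1 and maj σ + maj (φ σ) = C(n,2).
module Submission where

open import Defs
open import Data.Nat using (ℕ; _≤_; _∸_)
open import Data.Nat.Combinatorics using (_C_)
open import Data.Integer using (ℤ; +_; _-_)
open import Relation.Binary.PropositionalEquality using (_≡_)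

open import Data.Bool using (Bool; true; false; T; _∧_; not; if_then_else_)
open import Data.Bool.Properties using (T-∧; T-≡)
open import Data.Bool.ListAction using (all)
open import Data.Nat as ℕ using (zero; suc; _+_; _*_; _<_; _<ᵇ_; _≡ᵇ_; _⊔_; z≤n; s≤s)
open import Data.Nat.Properties
  using (<ᵇ⇒<; <⇒<ᵇ; ≡ᵇ⇒≡; <-asym; ≮⇒≥; <⇒≱; ≤⇒≯; ≤∧≢⇒<; ≤-trans; <⇒≤; m≤m⊔n; m≤n⇒m⊔n≡n;
         ⊔-identityʳ; *-identityʳ; +-assoc; ≤-refl; suc-injective)
open import Data.Nat.ListAction using (sum)
open import Data.Nat.ListAction.Properties using (sum-↭)
open import Data.Nat.Combinatorics using (nC1≡n; nCk+nC[k+1]≡[n+1]C[k+1])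
open import Data.Nat.Tactic.RingSolver using (solve-∀)
open import Data.Integer as ℤ using (-[1+_]; ∣_∣; -_; _<?_; _≟_; -<-; -<+; +<+)
open import Data.Integer.Properties using (∣-i∣≡∣i∣; neg-involutive; pos-+)
import Data.Integer.Tactic.RingSolver as ℤ-Solver
open import Data.Fin using (toℕ)
open import Data.Fin.Properties using (pigeonhole; toℕ<n; toℕ-injective; <⇒≢)
open import Data.List using (List; []; _∷_; _++_; map; concat; concatMap; filterᵇ; length; lookup; upTo)
open import Data.List.Properties using (filter-++; length-++; length-map; map-∘; map-cong)
open import Data.List.Membership.Propositional using (_∈_; find; lose)
open import Data.List.Membership.Propositional.Properties using (∈-concatMap⁺; ∈-concatMap⁻; ∈-upTo⁺)
open import Data.List.Relation.Unary.Any as Any using (here; there)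
open import Data.List.Relation.Unary.Any.Properties using (any⁺; any⁻; lookup-index)
open import Data.List.Relation.Unary.All as All using (All; []; _∷_)
open import Data.List.Relation.Unary.All.Properties using (all⁺)
open import Data.List.Relation.Unary.Linked as Linked using (Linked; []; [-]; _∷_)
import Data.List.Relation.Unary.Linked.Properties as Linked
open import Data.List.Relation.Binary.Pointwise as Pointwise using (Pointwise; []; _∷_; Pointwise-≡⇒≡)
open import Data.List.Relation.Binary.Pointwise.Properties using (Pointwise-length)
open import Data.List.Relation.Binary.Permutation.Propositional using (_↭_; refl; prep; swap)
import Data.List.Relation.Binary.Permutation.Propositional.Properties as ↭
open import Data.List.Relation.Binary.Subset.Propositional using (_⊆_)
open import Data.List.Relation.Binary.Subset.Propositional.Properties using (∷⁺ʳ; ∈-∷⁺ʳ; ⊆-refl)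
open import Data.Product using (_×_; _,_; proj₁; proj₂; ∃-syntax)
open import Data.Sum using (_⊎_; inj₁; inj₂)
open import Function using (_∘_; _on_; _⇔_; mk⇔; Equivalence)
open import Relation.Binary.Definitions using (DecidableEquality)
open import Relation.Nullary using (does; yes; no; contradiction)
open import Relation.Nullary.Decidable using (T?; dec-true; dec-false; does-⇔)
open import Relation.Binary.PropositionalEquality
  using (_≢_; refl; sym; trans; cong; cong₂; subst; subst₂; _≗_; module ≡-Reasoning)

open Equivalence using (to; from)

private
  variable
    A B : Set

count : (A → Bool) → List A → ℕ
count p xs = length (filterᵇ p xs)

count-++ : ∀ (p : A → Bool) xs ys → count p (xs ++ ys) ≡ count p xs + count p ys
count-++ p xs ys = trans (cong length (filter-++ (T? ∘ p) xs ys)) (length-++ (filterᵇ p xs))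

count-cong : ∀ {p q : A → Bool} → p ≗ q → count p ≗ count q
count-cong eq []       = refl
count-cong {p = p} {q} eq (x ∷ xs) with p x | q x | eq x
... | true  | true  | refl = cong suc (count-cong eq xs)
... | false | false | refl = count-cong eq xs

count-map : ∀ (p : B → Bool) (f : A → B) xs → count p (map f xs) ≡ count (p ∘ f) xs
count-map p f []       = refl
count-map p f (x ∷ xs) with p (f x)
... | true  = cong suc (count-map p f xs)
... | false = count-map p f xs

count-filterᵇ : ∀ (p q : A → Bool) xs → count p (filterᵇ q xs) ≡ count (λ x → q x ∧ p x) xs
count-filterᵇ p q []       = refl
count-filterᵇ p q (x ∷ xs) with q x
... | false = count-filterᵇ p q xs
... | true with p x
...   | true  = cong suc (count-filterᵇ p q xs)
...   | false = count-filterᵇ p q xs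

count-concatMap : ∀ (p : B → Bool) (f : A → List B) xs →
                  count p (concatMap f xs) ≡ sum (map (count p ∘ f) xs)
count-concatMap p f []       = refl
count-concatMap p f (x ∷ xs) =
  trans (count-++ p (f x) (concatMap f xs)) (cong (count p (f x) ℕ.+_) (count-concatMap p f xs))

involution-preserves : ∀ (p : A → Bool) (f : A → A) → (∀ x → f (f x) ≡ x) →
                       (∀ x → T (p x) → T (p (f x))) → ∀ x → p (f x) ≡ p x
involution-preserves p f inv pres x with p x in px | p (f x) in pfx
... | true  | true  = refl
... | false | false = refl
... | true  | false = contradiction (pres x (from T-≡ px)) (subst T pfx)
... | false | true  =
  contradiction (subst (T ∘ p) (inv x) (pres (f x) (from T-≡ pfx))) (subst T px)

linked-++⁻ʳ : ∀ {R : A → A → Set} xs {ys} → Linked R (xs ++ ys) → Linked R ys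
linked-++⁻ʳ []       linked = linked
linked-++⁻ʳ (x ∷ xs) linked = linked-++⁻ʳ xs (Linked.tail linked)

covers⇒≤length : ∀ n (v : List ℕ) → (∀ {i} → i < n → suc i ∈ v) → n ≤ length v
covers⇒≤length n v cover = ≮⇒≥ λ short →
  let i , j , i<j , same-position = pigeonhole short (λ k → Any.index (cover (toℕ<n k))) in
  <⇒≢ i<j (toℕ-injective (suc-injective (begin
    suc (toℕ i)                              ≡⟨ lookup-index (cover (toℕ<n i)) ⟩
    lookup v (Any.index (cover (toℕ<n i)))   ≡⟨ cong (lookup v) same-position ⟩
    lookup v (Any.index (cover (toℕ<n j)))   ≡⟨ lookup-index (cover (toℕ<n j)) ⟨
    suc (toℕ j)                              ∎)))
  where open ≡-Reasoning

linked-≢⊎⊆-shorter : DecidableEquality A → ∀ (v : List A) →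
                     Linked _≢_ v ⊎ ∃[ w ] (suc (length w) ≡ length v × v ⊆ w)
linked-≢⊎⊆-shorter _≟ᴬ_ []          = inj₁ []
linked-≢⊎⊆-shorter _≟ᴬ_ (x ∷ [])    = inj₁ [-]
linked-≢⊎⊆-shorter _≟ᴬ_ (x ∷ y ∷ v) with x ≟ᴬ y | linked-≢⊎⊆-shorter _≟ᴬ_ (y ∷ v)
... | yes refl | _                    = inj₂ (x ∷ v , refl , ∈-∷⁺ʳ (here refl) ⊆-refl)
... | no x≢y   | inj₁ linked          = inj₁ (x≢y ∷ linked)
... | no _     | inj₂ (w , len , v⊆w) = inj₂ (x ∷ w , cong suc len , ∷⁺ʳ x v⊆w)

covers-exactly⇒linked-≢ : ∀ n (v : List ℕ) → length v ≡ n → (∀ {i} → i < n → suc i ∈ v) → Linked _≢_ v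
covers-exactly⇒linked-≢ n v len cover with linked-≢⊎⊆-shorter ℕ._≟_ v
... | inj₁ linked          = linked
... | inj₂ (w , len′ , v⊆w) =
  contradiction (covers⇒≤length n w (v⊆w ∘ cover)) (<⇒≱ (subst (length w <_) (trans len′ len) ≤-refl))

-- Negating the rises of a signed word

negateIf : Bool → ℤ → ℤ
negateIf b a = if b then - a else a

∣negateIf∣ : ∀ b a → ∣ negateIf b a ∣ ≡ ∣ a ∣
∣negateIf∣ true  a = ∣-i∣≡∣i∣ a
∣negateIf∣ false a = refl

negateIf-involutive : ∀ b a → negateIf b (negateIf b a) ≡ a
negateIf-involutive true  a = neg-involutive a
negateIf-involutive false a = refl

-- An entry is a rise when its absolute value exceeds that of its predecessor;
-- the first argument of negateRisesAfter is the absolute value of the predecessor.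
negateRisesAfter : ℕ → List ℤ → List ℤ
negateRisesAfter p []       = []
negateRisesAfter p (y ∷ ys) = negateIf (p <ᵇ ∣ y ∣) y ∷ negateRisesAfter ∣ y ∣ ys

negateRises : List ℤ → List ℤ
negateRises []       = []
negateRises (x ∷ xs) = x ∷ negateRisesAfter ∣ x ∣ xs

negateRisesAfter-involutive : ∀ p ys → negateRisesAfter p (negateRisesAfter p ys) ≡ ys
negateRisesAfter-involutive p []       = refl
negateRisesAfter-involutive p (y ∷ ys) rewrite ∣negateIf∣ (p <ᵇ ∣ y ∣) y =
  cong₂ _∷_ (negateIf-involutive (p <ᵇ ∣ y ∣) y) (negateRisesAfter-involutive ∣ y ∣ ys)

negateRises-involutive : ∀ σ → negateRises (negateRises σ) ≡ σ
negateRises-involutive []       = refl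
negateRises-involutive (x ∷ xs) = cong (x ∷_) (negateRisesAfter-involutive ∣ x ∣ xs)

map-negateByAbs-letters↭ : ∀ (s : ℕ → Bool) n → map (λ a → negateIf (s ∣ a ∣) a) (letters n) ↭ letters n
map-negateByAbs-letters↭ s n = go (upTo n)
  where
  go : ∀ is → map (λ a → negateIf (s ∣ a ∣) a) (concatMap (λ i → + suc i ∷ -[1+ i ] ∷ []) is)
              ↭ concatMap (λ i → + suc i ∷ -[1+ i ] ∷ []) is
  go []       = refl
  go (i ∷ is) with s (suc i)
  ... | true  = swap _ _ (go is)
  ... | false = prep _ (prep _ (go is))

sum-letters-negateByAbs : ∀ (s : ℕ → Bool) n (g : ℤ → ℕ) →
                          sum (map (λ a → g (negateIf (s ∣ a ∣) a)) (letters n)) ≡ sum (map g (letters n))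
sum-letters-negateByAbs s n g =
  trans (cong sum (map-∘ (letters n))) (sum-↭ (↭.map⁺ g (map-negateByAbs-letters↭ s n)))

count-words-suc : ∀ n k (f : List ℤ → Bool) →
                  count f (words n (suc k)) ≡ sum (map (λ a → count (f ∘ (a ∷_)) (words n k)) (letters n))
count-words-suc n k f =
  trans (count-concatMap f (λ a → map (a ∷_) (words n k)) (letters n))
        (cong sum (map-cong (λ a → count-map f (a ∷_) (words n k)) (letters n)))

count-words-negateRisesAfter : ∀ n k p (f : List ℤ → Bool) →
                               count (f ∘ negateRisesAfter p) (words n k) ≡ count f (words n k)
count-words-negateRisesAfter n zero    p f with f []  -- refl alone fails: filterᵇ gets stuck on f []
... | true  = refl
... | false = refl
count-words-negateRisesAfter n (suc k) p f = begin
  count (f ∘ negateRisesAfter p) (words n (suc k))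
    ≡⟨ count-words-suc n k (f ∘ negateRisesAfter p) ⟩
  sum (map (λ a → count (f ∘ (negateIf (p <ᵇ ∣ a ∣) a ∷_) ∘ negateRisesAfter ∣ a ∣) (words n k)) (letters n))
    ≡⟨ cong sum (map-cong (λ a → count-words-negateRisesAfter n k ∣ a ∣ (f ∘ (negateIf (p <ᵇ ∣ a ∣) a ∷_)))
                          (letters n)) ⟩
  sum (map (λ a → count (f ∘ (negateIf (p <ᵇ ∣ a ∣) a ∷_)) (words n k)) (letters n))
    ≡⟨ sum-letters-negateByAbs (p <ᵇ_) n (λ a → count (f ∘ (a ∷_)) (words n k)) ⟩
  sum (map (λ a → count (f ∘ (a ∷_)) (words n k)) (letters n))
    ≡⟨ count-words-suc n k f ⟨
  count f (words n (suc k)) ∎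
  where open ≡-Reasoning

count-words-negateRises : ∀ n k (f : List ℤ → Bool) →
                          count (f ∘ negateRises) (words n k) ≡ count f (words n k)
count-words-negateRises n zero    f with f []
... | true  = refl
... | false = refl
count-words-negateRises n (suc k) f = begin
  count (f ∘ negateRises) (words n (suc k))
    ≡⟨ count-words-suc n k (f ∘ negateRises) ⟩
  sum (map (λ a → count (f ∘ (a ∷_) ∘ negateRisesAfter ∣ a ∣) (words n k)) (letters n))
    ≡⟨ cong sum (map-cong (λ a → count-words-negateRisesAfter n k ∣ a ∣ (f ∘ (a ∷_))) (letters n)) ⟩
  sum (map (λ a → count (f ∘ (a ∷_)) (words n k)) (letters n))
    ≡⟨ count-words-suc n k f ⟨
  count f (words n (suc k)) ∎
  where open ≡-Reasoning

-- Complementary descent sets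

isNegative : ℤ → Bool
isNegative (+ _)    = false
isNegative -[1+ _ ] = true

isNegative-neg : ∀ y → 0 < ∣ y ∣ → isNegative (- y) ≡ not (isNegative y)
isNegative-neg (+ suc n) _ = refl
isNegative-neg -[1+ n ]  _ = refl

isDescent-rise : ∀ x y → ∣ x ∣ < ∣ y ∣ → isDescent x y ≡ isNegative y
isDescent-rise (+ k)    (+ suc n) lt       = dec-false (+ suc n <? + k) λ { (+<+ p) → <-asym p lt }
isDescent-rise -[1+ k ] (+ suc n) _        = dec-false (+ suc n <? -[1+ k ]) λ ()
isDescent-rise (+ k)    -[1+ n ]  _        = dec-true (-[1+ n ] <? + k) -<+
isDescent-rise -[1+ k ] -[1+ n ]  (s≤s lt) = dec-true (-[1+ n ] <? -[1+ k ]) (-<- lt)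

isDescent-fall : ∀ x y → ∣ y ∣ < ∣ x ∣ → isDescent x y ≡ not (isNegative x)
isDescent-fall (+ suc n) (+ k)    lt       = dec-true (+ k <? + suc n) (+<+ lt)
isDescent-fall (+ suc n) -[1+ k ] _        = dec-true (-[1+ k ] <? + suc n) -<+
isDescent-fall -[1+ n ]  (+ k)    _        = dec-false (+ k <? -[1+ n ]) λ ()
isDescent-fall -[1+ n ]  -[1+ k ] (s≤s lt) = dec-false (-[1+ k ] <? -[1+ n ]) λ { (-<- p) → <-asym p lt }

isDescent-negate-rise : ∀ x x' y → ∣ x ∣ < ∣ y ∣ → ∣ x' ∣ ≡ ∣ x ∣ → isDescent x' (- y) ≡ not (isDescent x y)
isDescent-negate-rise x x' y lt same = begin
  isDescent x' (- y)      ≡⟨ isDescent-rise x' (- y) (subst₂ _<_ (sym same) (sym (∣-i∣≡∣i∣ y)) lt) ⟩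
  isNegative (- y)        ≡⟨ isNegative-neg y (≤-trans (s≤s z≤n) lt) ⟩
  not (isNegative y)      ≡⟨ cong not (isDescent-rise x y lt) ⟨
  not (isDescent x y)     ∎
  where open ≡-Reasoning

isDescent-negate-fall : ∀ x y y' → ∣ y ∣ < ∣ x ∣ → ∣ y' ∣ ≡ ∣ y ∣ → isDescent (- x) y' ≡ not (isDescent x y)
isDescent-negate-fall x y y' lt same = begin
  isDescent (- x) y'           ≡⟨ isDescent-fall (- x) y' (subst₂ _<_ (sym same) (sym (∣-i∣≡∣i∣ x)) lt) ⟩
  not (isNegative (- x))       ≡⟨ cong not (isNegative-neg x (≤-trans (s≤s z≤n) lt)) ⟩
  not (not (isNegative x))     ≡⟨ cong not (isDescent-fall x y lt) ⟨
  not (isDescent x y)          ∎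
  where open ≡-Reasoning

data DescentComplement : List ℤ → List ℤ → Set where
  []  : DescentComplement [] []
  [-] : ∀ {x x'} → DescentComplement (x ∷ []) (x' ∷ [])
  _∷_ : ∀ {x y xs x' y' xs'} → isDescent x' y' ≡ not (isDescent x y) →
        DescentComplement (y ∷ xs) (y' ∷ xs') → DescentComplement (x ∷ y ∷ xs) (x' ∷ y' ∷ xs')

weight-complement : ∀ {b b'} → b' ≡ not b → ∀ i M M' →
                    ((if b then i else 0) + M) + ((if b' then i else 0) + M') ≡ i + (M + M')
weight-complement {true}  refl i M M' = +-assoc i M M'
weight-complement {false} refl i M M' = left-comm M i M'
  where
  left-comm : ∀ a b c → a + (b + c) ≡ b + (a + c)
  left-comm = solve-∀

des-complement : ∀ {σ τ} → DescentComplement σ τ → des σ + des τ ≡ length σ ∸ 1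
des-complement []      = refl
des-complement [-]     = refl
des-complement (e ∷ c) = trans (weight-complement e 1 _ _) (cong suc (des-complement c))

C2-suc : ∀ L → suc L C 2 ≡ L + L C 2
C2-suc L = trans (sym (nCk+nC[k+1]≡[n+1]C[k+1] L 1)) (cong (ℕ._+ L C 2) (nC1≡n L))

majFrom-complement : ∀ {σ τ} → DescentComplement σ τ → ∀ i →
                     majFrom i σ + majFrom i τ ≡ (length σ ∸ 1) * i + (length σ ∸ 1) C 2
majFrom-complement []      i = refl
majFrom-complement [-]     i = refl
majFrom-complement (_∷_ {x} {y} {xs} {x'} {y'} {xs'} e c) i = begin
  majFrom i (x ∷ y ∷ xs) + majFrom i (x' ∷ y' ∷ xs')
    ≡⟨ weight-complement e i _ _ ⟩
  i + (majFrom (suc i) (y ∷ xs) + majFrom (suc i) (y' ∷ xs'))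
    ≡⟨ cong (i ℕ.+_) (majFrom-complement c (suc i)) ⟩
  i + (L * suc i + L C 2)
    ≡⟨ rearrange i L (L C 2) ⟩
  suc L * i + (L + L C 2)
    ≡⟨ cong (suc L * i ℕ.+_) (C2-suc L) ⟨
  suc L * i + suc L C 2 ∎
  where
  open ≡-Reasoning
  L : ℕ
  L = length xs
  rearrange : ∀ i L c → i + (L * suc i + c) ≡ suc L * i + (L + c)
  rearrange = solve-∀

maj-complement : ∀ {σ τ} → DescentComplement σ τ → maj σ + maj τ ≡ length σ C 2
maj-complement {σ} c = trans (majFrom-complement c 1) (closed-form (length σ))
  where
  closed-form : ∀ L → (L ∸ 1) * 1 + (L ∸ 1) C 2 ≡ L C 2
  closed-form zero    = refl
  closed-form (suc L) = trans (cong (ℕ._+ L C 2) (*-identityʳ L)) (sym (C2-suc L))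

complement-≡⇔ : ∀ i j d → (j ≡ (i ℤ.+ j) - d) ⇔ (i ≡ d)
complement-≡⇔ i j d = mk⇔ forward (λ { refl → sym (cancelˡ i j) })
  where
  open ≡-Reasoning
  cancelˡ : ∀ i j → (i ℤ.+ j) - i ≡ j
  cancelˡ = ℤ-Solver.solve-∀
  cancelʳ : ∀ i j → (i ℤ.+ j) - j ≡ i
  cancelʳ = ℤ-Solver.solve-∀
  double-minus : ∀ k d → k - (k - d) ≡ d
  double-minus = ℤ-Solver.solve-∀
  forward : j ≡ (i ℤ.+ j) - d → i ≡ d
  forward e = begin
    i                            ≡⟨ cancelʳ i j ⟨
    (i ℤ.+ j) - j                ≡⟨ cong (_-_ (i ℤ.+ j)) e ⟩
    (i ℤ.+ j) - ((i ℤ.+ j) - d)  ≡⟨ double-minus (i ℤ.+ j) d ⟩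
    d                            ∎

does-≟-complement : ∀ a b N d → a + b ≡ N → does (+ b ≟ + N - d) ≡ does (+ a ≟ d)
does-≟-complement a b _ d refl =
  does-⇔ (subst (λ k → (+ b ≡ k - d) ⇔ (+ a ≡ d)) (sym (pos-+ a b)) (complement-≡⇔ (+ a) (+ b) d))
          (+ b ≟ + (a + b) - d) (+ a ≟ d)

hasStatistics : ℤ → ℤ → List ℤ → Bool
hasStatistics d m σ = does (+ des σ ≟ d) ∧ does (+ maj σ ≟ m)

hasStatistics-complement : ∀ n d m {σ τ} → DescentComplement σ τ → length σ ≡ n →
                           hasStatistics (+ (n ∸ 1) - d) (+ (n C 2) - m) τ ≡ hasStatistics d m σ
hasStatistics-complement _ d m c refl =
  cong₂ _∧_ (does-≟-complement _ _ _ d (des-complement c)) (does-≟-complement _ _ _ m (maj-complement c))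

-- Merging-free partitions

SameAbs : List ℤ → List ℤ → Set
SameAbs = Pointwise (_≡_ on ∣_∣)

minAbs-cong : ∀ {v w} → SameAbs v w → minAbs v ≡ minAbs w
minAbs-cong []      = refl
minAbs-cong (e ∷ _) = e

maxAbs-cong : ∀ {v w} → SameAbs v w → maxAbs v ≡ maxAbs w
maxAbs-cong []       = refl
maxAbs-cong (e ∷ es) = cong₂ _⊔_ e (maxAbs-cong es)

absIncreasing-cong : ∀ {v w} → SameAbs v w → absIncreasing v ≡ absIncreasing w
absIncreasing-cong []                = refl
absIncreasing-cong (e ∷ [])          = refl
absIncreasing-cong (e ∷ es@(e' ∷ _)) = cong₂ _∧_ (cong₂ _<ᵇ_ e e') (absIncreasing-cong es)

coversN-cong : ∀ n {v w} → SameAbs v w → coversN n v ≡ coversN n w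
coversN-cong n same =
  cong₂ (λ l as → (l ≡ᵇ n) ∧ all (λ i → occurs (suc i) as) (upTo n))
        (Pointwise-length same) (Pointwise-≡⇒≡ (Pointwise.map⁺ ∣_∣ ∣_∣ same))

concat-map-sameAbs : ∀ (f : List ℤ → List ℤ) → (∀ b → SameAbs (f b) b) →
                     ∀ π → SameAbs (concat (map f π)) (concat π)
concat-map-sameAbs f same []      = []
concat-map-sameAbs f same (b ∷ π) = Pointwise.++⁺ (same b) (concat-map-sameAbs f same π)

mergingFreePartition : ℕ → List (List ℤ) → Bool
mergingFreePartition n π = isTypeBPartition n π ∧ mergingFree π

mergingFreePartition-map : ∀ (f : List ℤ → List ℤ) → (∀ b → SameAbs (f b) b) →
                           (∀ b → blockOK (f b) ≡ blockOK b) →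
                           ∀ n π → mergingFreePartition n (map f π) ≡ mergingFreePartition n π
mergingFreePartition-map f same ok n π =
  cong₂ _∧_ (cong₂ _∧_ (blocks π) (cong₂ _∧_ (mins π) (coversN-cong n (concat-map-sameAbs f same π))))
            (merging π)
  where
  blocks : ∀ π → all blockOK (map f π) ≡ all blockOK π
  blocks []      = refl
  blocks (b ∷ π) = cong₂ _∧_ (ok b) (blocks π)
  mins : ∀ π → minsIncreasing (map f π) ≡ minsIncreasing π
  mins []          = refl
  mins (b ∷ [])    = refl
  mins (b ∷ c ∷ π) = cong₂ _∧_ (cong₂ _<ᵇ_ (minAbs-cong (same b)) (minAbs-cong (same c))) (mins (c ∷ π))
  merging : ∀ π → mergingFree (map f π) ≡ mergingFree π
  merging []          = refl
  merging (b ∷ [])    = refl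
  merging (b ∷ c ∷ π) =
    cong₂ _∧_ (cong not (cong₂ _<ᵇ_ (maxAbs-cong (same b)) (minAbs-cong (same c)))) (merging (c ∷ π))

negateTail : List ℤ → List ℤ
negateTail []       = []
negateTail (x ∷ xs) = x ∷ map -_ xs

map-neg-sameAbs : ∀ xs → SameAbs (map -_ xs) xs
map-neg-sameAbs []       = []
map-neg-sameAbs (x ∷ xs) = ∣-i∣≡∣i∣ x ∷ map-neg-sameAbs xs

negateTail-sameAbs : ∀ b → SameAbs (negateTail b) b
negateTail-sameAbs []       = []
negateTail-sameAbs (x ∷ xs) = refl ∷ map-neg-sameAbs xs

blockOK-negateTail : ∀ b → blockOK (negateTail b) ≡ blockOK b
blockOK-negateTail []       = refl
blockOK-negateTail (x ∷ xs) = cong (isPos x ∧_) (absIncreasing-cong (negateTail-sameAbs (x ∷ xs)))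

-- The cutting function used by splits is local to its definition; passing the list of cuttings lets
-- unification recover it.
splits-sound : ∀ σ {π} → π ∈ splits σ → concat π ≡ σ
splits-sound []       (here refl) = refl
splits-sound (x ∷ xs) π∈ with find (∈-concatMap⁻ _ {xs = splits xs} π∈)
... | []    , ρ∈ , here refl         = cong (x ∷_) (splits-sound xs ρ∈)
... | _ ∷ _ , ρ∈ , here refl         = cong (x ∷_) (splits-sound xs ρ∈)
... | _ ∷ _ , ρ∈ , there (here refl) = cong (x ∷_) (splits-sound xs ρ∈)

block-∈-splits : ∀ x xs ρ → ρ ∈ splits (concat ρ) → ((x ∷ xs) ∷ ρ) ∈ splits (x ∷ xs ++ concat ρ)
block-∈-splits x []       []        _  = here refl
block-∈-splits x []       ρ@(_ ∷ _) ρ∈ = ∈-concatMap⁺ _ {xs = splits (concat ρ)} (lose ρ∈ (here refl))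
block-∈-splits x (y ∷ ys) ρ         ρ∈ =
  ∈-concatMap⁺ _ {xs = splits (y ∷ ys ++ concat ρ)} (lose (block-∈-splits y ys ρ ρ∈) (there (here refl)))

splits-complete : ∀ {π} → All (_≢ []) π → π ∈ splits (concat π)
splits-complete []                          = here refl
splits-complete {[] ∷ _}       (ne ∷ _)     = contradiction refl ne
splits-complete {(x ∷ xs) ∷ ρ} (_  ∷ nes)   = block-∈-splits x xs ρ (splits-complete nes)

coversN⇒length : ∀ n w → T (coversN n w) → length w ≡ n
coversN⇒length n w h = ≡ᵇ⇒≡ (length w) n (proj₁ (to T-∧ h))

coversN⇒covers : ∀ n w → T (coversN n w) → ∀ {i} → i < n → suc i ∈ map ∣_∣ w
coversN⇒covers n w h i<n =
  Any.map (≡ᵇ⇒≡ _ _) (any⁻ _ (map ∣_∣ w)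
    (All.lookup (all⁺ (λ i → occurs (suc i) (map ∣_∣ w)) (upTo n) (proj₂ (to (T-∧ {length w ≡ᵇ n}) h)))
                (∈-upTo⁺ i<n)))

coversN⇒absDistinct : ∀ n w → T (coversN n w) → Linked (_≢_ on ∣_∣) w
coversN⇒absDistinct n w h =
  Linked.map⁻ (covers-exactly⇒linked-≢ n (map ∣_∣ w) (trans (length-map ∣_∣ w) (coversN⇒length n w h))
                                         (coversN⇒covers n w h))

absIncreasing⇒linked : ∀ w → T (absIncreasing w) → Linked (_<_ on ∣_∣) w
absIncreasing⇒linked []          _ = []
absIncreasing⇒linked (x ∷ [])    _ = [-]
absIncreasing⇒linked (x ∷ y ∷ w) h =
  <ᵇ⇒< _ _ (proj₁ (to T-∧ h)) ∷ absIncreasing⇒linked (y ∷ w) (proj₂ (to (T-∧ {∣ x ∣ <ᵇ ∣ y ∣}) h))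

blockOK⇒absIncreasing : ∀ x xs → T (blockOK (x ∷ xs)) → Linked (_<_ on ∣_∣) (x ∷ xs)
blockOK⇒absIncreasing x xs h = absIncreasing⇒linked (x ∷ xs) (proj₂ (to (T-∧ {isPos x}) h))

blockOK⇒≢[] : ∀ b → T (blockOK b) → b ≢ []
blockOK⇒≢[] (_ ∷ _) _ ()

allBlockOK-tail : ∀ b π → T (all blockOK (b ∷ π)) → T (all blockOK π)
allBlockOK-tail b π h = proj₂ (to (T-∧ {blockOK b}) h)

mergingFree-tail : ∀ b π → T (mergingFree (b ∷ π)) → T (mergingFree π)
mergingFree-tail b []      _ = _
mergingFree-tail b (c ∷ π) h = proj₂ (to (T-∧ {not (maxAbs b <ᵇ minAbs c)}) h)

minsIncreasing-tail : ∀ b π → T (minsIncreasing (b ∷ π)) → T (minsIncreasing π)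
minsIncreasing-tail b []      _ = _
minsIncreasing-tail b (c ∷ π) h = proj₂ (to (T-∧ {minAbs b <ᵇ minAbs c}) h)

mergingFree⇒minAbs≤maxAbs : ∀ b c π → T (mergingFree (b ∷ c ∷ π)) → minAbs c ≤ maxAbs b
mergingFree⇒minAbs≤maxAbs b c π h =
  ≮⇒≥ λ lt → subst (T ∘ not) (to T-≡ (<⇒<ᵇ lt)) (proj₁ (to T-∧ h))

minsIncreasing⇒minAbs< : ∀ b c π → T (minsIncreasing (b ∷ c ∷ π)) → minAbs b < minAbs c
minsIncreasing⇒minAbs< b c π h = <ᵇ⇒< _ _ (proj₁ (to T-∧ h))

junction : ∀ b π → T (all blockOK π) → T (mergingFree (b ∷ π)) → minAbs (concat π) ≤ maxAbs b
junction b []            _ _  = z≤n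
junction b ((r ∷ c) ∷ π) _ mf = mergingFree⇒minAbs≤maxAbs b (r ∷ c) π mf

record IsMergingFreePartition (n : ℕ) (π : List (List ℤ)) : Set where
  field
    blocksOK   : T (all blockOK π)
    minsInc    : T (minsIncreasing π)
    coversAll  : T (coversN n (concat π))
    mergeFree  : T (mergingFree π)

isMergingFreePartition : ∀ n π → T (mergingFreePartition n π) → IsMergingFreePartition n π
isMergingFreePartition n π h = record
  { blocksOK  = blocks
  ; minsInc   = proj₁ (to T-∧ rest)
  ; coversAll = proj₂ (to (T-∧ {minsIncreasing π}) rest)
  ; mergeFree = proj₂ (to (T-∧ {isTypeBPartition n π}) h)
  }
  where
  partition : T (isTypeBPartition n π)
  partition = proj₁ (to T-∧ h)
  blocks : T (all blockOK π)
  blocks = proj₁ (to T-∧ partition)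
  rest : T (minsIncreasing π ∧ coversN n (concat π))
  rest = proj₂ (to (T-∧ {all blockOK π}) partition)

inRB⇒partition : ∀ n σ → T (inRB n σ) → ∃[ π ] (concat π ≡ σ × T (mergingFreePartition n π))
inRB⇒partition n σ h = let π , π∈ , ok = find (any⁻ _ (splits σ) h) in π , splits-sound σ π∈ , ok

partition⇒inRB : ∀ n π → T (mergingFreePartition n π) → T (inRB n (concat π))
partition⇒inRB n π ok = any⁺ _ (lose (splits-complete nonempty) ok)
  where
  nonempty : All (_≢ []) π
  nonempty = All.map (λ {b} → blockOK⇒≢[] b)
                     (all⁺ blockOK π (IsMergingFreePartition.blocksOK (isMergingFreePartition n π ok)))

maxAbs-rise : ∀ x y ys → ∣ x ∣ < ∣ y ∣ → maxAbs (x ∷ y ∷ ys) ≡ maxAbs (y ∷ ys)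
maxAbs-rise x y ys lt = m≤n⇒m⊔n≡n (≤-trans (<⇒≤ lt) (m≤m⊔n ∣ y ∣ (maxAbs ys)))

negateIf-rise : ∀ p y → p < ∣ y ∣ → negateIf (p <ᵇ ∣ y ∣) y ≡ - y
negateIf-rise p y lt rewrite to T-≡ (<⇒<ᵇ lt) = refl

negateIf-nonrise : ∀ p y → ∣ y ∣ ≤ p → negateIf (p <ᵇ ∣ y ∣) y ≡ y
negateIf-nonrise p y le with p <ᵇ ∣ y ∣ in eq
... | true  = contradiction (<ᵇ⇒< p ∣ y ∣ (from T-≡ eq)) (≤⇒≯ le)
... | false = refl

negateRisesAfter-block : ∀ x xs R → Linked (_<_ on ∣_∣) (x ∷ xs) → minAbs R ≤ maxAbs (x ∷ xs) →
                         negateRisesAfter ∣ x ∣ (xs ++ R) ≡ map -_ xs ++ negateRises R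
negateRisesAfter-block x []       []      _             _   = refl
negateRisesAfter-block x []       (r ∷ R) _             r≤x =
  cong (_∷ negateRisesAfter ∣ r ∣ R) (negateIf-nonrise ∣ x ∣ r (subst (∣ r ∣ ≤_) (⊔-identityʳ ∣ x ∣) r≤x))
negateRisesAfter-block x (y ∷ ys) R       (x<y ∷ rises) r≤ =
  cong₂ _∷_ (negateIf-rise ∣ x ∣ y x<y)
            (negateRisesAfter-block y ys R rises (subst (minAbs R ≤_) (maxAbs-rise x y ys x<y) r≤))

negateRises-concat : ∀ π → T (all blockOK π) → T (mergingFree π) →
                     negateRises (concat π) ≡ concat (map negateTail π)
negateRises-concat []              _  _  = refl
negateRises-concat ((x ∷ xs) ∷ π) ok mf = cong (x ∷_) (begin
  negateRisesAfter ∣ x ∣ (xs ++ concat π)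
    ≡⟨ negateRisesAfter-block x xs (concat π) (blockOK⇒absIncreasing x xs (proj₁ (to T-∧ ok)))
                                              (junction (x ∷ xs) π ok′ mf) ⟩
  map -_ xs ++ negateRises (concat π)
    ≡⟨ cong (map -_ xs ++_) (negateRises-concat π ok′ (mergingFree-tail (x ∷ xs) π mf)) ⟩
  map -_ xs ++ concat (map negateTail π) ∎)
  where
  open ≡-Reasoning
  ok′ : T (all blockOK π)
  ok′ = allBlockOK-tail (x ∷ xs) π ok

-- Inside the block each rise is negated; the junction with the next block is a strict fall (adjacent
-- absolute values are distinct), complemented because the last entry of the block has been negated.
risingRun-complement : ∀ y ys {R R'} → Linked (_<_ on ∣_∣) (y ∷ ys) → minAbs R ≤ maxAbs (y ∷ ys) →
                       Linked (_≢_ on ∣_∣) (y ∷ ys ++ R) → SameAbs R' R → DescentComplement R R' →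
                       DescentComplement (y ∷ ys ++ R) (- y ∷ map -_ ys ++ R')
risingRun-complement y []       {[]}    _ _ _ [] [] = [-]
risingRun-complement y []       {r ∷ _} {r' ∷ _} _ r≤y (y≢r ∷ _) (same ∷ _) c =
  isDescent-negate-fall y r r' r<y same ∷ c
  where
  r<y : ∣ r ∣ < ∣ y ∣
  r<y = ≤∧≢⇒< (subst (∣ r ∣ ≤_) (⊔-identityʳ ∣ y ∣) r≤y) (y≢r ∘ sym)
risingRun-complement y (z ∷ zs) {R} (y<z ∷ rises) r≤ (_ ∷ distinct) same c =
  isDescent-negate-rise y (- y) z y<z (∣-i∣≡∣i∣ y) ∷
  risingRun-complement z zs rises (subst (minAbs R ≤_) (maxAbs-rise y z zs y<z) r≤) distinct same c

concat-complement : ∀ π → T (all blockOK π) → T (minsIncreasing π) → T (mergingFree π) →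
                    Linked (_≢_ on ∣_∣) (concat π) → DescentComplement (concat π) (concat (map negateTail π))
concat-complement []                      _  _  _  _        = []
concat-complement ((x ∷ []) ∷ [])         _  _  _  _        = [-]
concat-complement ((x ∷ []) ∷ c ∷ π)      _  mi mf _        =
  contradiction (subst (minAbs c ≤_) (⊔-identityʳ ∣ x ∣) (mergingFree⇒minAbs≤maxAbs (x ∷ []) c π mf))
                (<⇒≱ (minsIncreasing⇒minAbs< (x ∷ []) c π mi))
concat-complement ((x ∷ y ∷ ys) ∷ π) ok mi mf distinct
  with blockOK⇒absIncreasing x (y ∷ ys) (proj₁ (to T-∧ ok))
... | x<y ∷ rises =
  isDescent-negate-rise x x y x<y refl ∷
  risingRun-complement y ys rises
    (subst (minAbs (concat π) ≤_) (maxAbs-rise x y ys x<y) (junction _ π ok′ mf))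
    (Linked.tail distinct) (concat-map-sameAbs negateTail negateTail-sameAbs π)
    (concat-complement π ok′ (minsIncreasing-tail _ π mi) (mergingFree-tail _ π mf)
                       (linked-++⁻ʳ (x ∷ y ∷ ys) distinct))
  where
  ok′ : T (all blockOK π)
  ok′ = allBlockOK-tail (x ∷ y ∷ ys) π ok

negateRises-inRB : ∀ n σ → T (inRB n σ) → T (inRB n (negateRises σ))
negateRises-inRB n σ h with inRB⇒partition n σ h
... | π , refl , ok = subst (T ∘ inRB n) (sym (negateRises-concat π blocksOK mergeFree))
  (partition⇒inRB n (map negateTail π)
    (subst T (sym (mergingFreePartition-map negateTail negateTail-sameAbs blockOK-negateTail n π)) ok))
  where open IsMergingFreePartition (isMergingFreePartition n π ok)

RB-descentComplement : ∀ n σ → T (inRB n σ) → DescentComplement σ (negateRises σ) × length σ ≡ n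
RB-descentComplement n σ h with inRB⇒partition n σ h
... | π , refl , ok =
  subst (DescentComplement (concat π)) (sym (negateRises-concat π blocksOK mergeFree))
        (concat-complement π blocksOK minsInc mergeFree (coversN⇒absDistinct n (concat π) coversAll)) ,
  coversN⇒length n (concat π) coversAll
  where open IsMergingFreePartition (isMergingFreePartition n π ok)

inRB-negateRises : ∀ n σ → inRB n (negateRises σ) ≡ inRB n σ
inRB-negateRises n = involution-preserves (inRB n) negateRises negateRises-involutive (negateRises-inRB n)

inRBWithStatistics : ℕ → ℤ → ℤ → List ℤ → Bool
inRBWithStatistics n d m σ = inRB n σ ∧ hasStatistics d m σ

RB-statistics-negateRises : ∀ n d m σ →
  inRBWithStatistics n d m σ ≡ inRBWithStatistics n (+ (n ∸ 1) - d) (+ (n C 2) - m) (negateRises σ)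
RB-statistics-negateRises n d m σ rewrite inRB-negateRises n σ with inRB n σ in h
... | false = refl
... | true  = let c , len = RB-descentComplement n σ (from T-≡ h) in
              sym (hasStatistics-complement n d m c len)

mainTheorem14 : (n : ℕ) → 1 ≤ n → (d m : ℤ) →
    coeffG n d m ≡ coeffG n (+ (n ∸ 1) - d) (+ (n C 2) - m)
mainTheorem14 n _ d m = begin
  coeffG n d m
    ≡⟨ count-filterᵇ (hasStatistics d m) (inRB n) (words n n) ⟩
  count (inRBWithStatistics n d m) (words n n)
    ≡⟨ count-cong (RB-statistics-negateRises n d m) (words n n) ⟩
  count (inRBWithStatistics n d′ m′ ∘ negateRises) (words n n)
    ≡⟨ count-words-negateRises n n (inRBWithStatistics n d′ m′) ⟩
  count (inRBWithStatistics n d′ m′) (words n n)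
    ≡⟨ count-filterᵇ (hasStatistics d′ m′) (inRB n) (words n n) ⟨
  coeffG n d′ m′ ∎
  where
  open ≡-Reasoning
  d′ m′ : ℤ
  d′ = + (n ∸ 1) - d
  m′ = + (n C 2) - m
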